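{- Let $p$ be a prime, $\nu\in\mathbb{Z}_{\ge0}$, $N$ a nonzero integer, and $\gamma=(\frac{\gamma_1}{N},\frac{\gamma_2}{N})\in U(N)'=\frac1N\mathbb{Z}^2$ with $\gamma_1,\gamma_2\in\mathbb{Z}$. Write $p^{\nu_N}\,\|\,N$, $p^{\nu_\gamma}\,\|\,\gcd(\gamma_1,\gamma_2)$ (with $\nu_\gamma=\infty$ if $\gamma_1=\gamma_2=0$), and let $n=\ell-\frac{\gamma_1\gamma_2}{N}$ with $\ell\in\mathbb{Z}$. Put $\nu_{\min}=\min(\nu,\nu_\gamma,\nu_N)$. Then \[N^{U(N)}_{\gamma,n}(p^\nu)=\begin{cases}0, & \text{if } p^{\nu_{\min}}\nmid \ell,\\ p^{2\nu_N}N^{U(1)}_{0,\tilde n}(p^{\nu-\nu_N}), & \text{if } \nu_N\le\min(\nu,\nu_\gamma)\text{ and } p^{\nu_{\min}}\mid\ell,\\ p^{\nu+\min(\nu,\nu_\gamma)}, & \text{if }\nu_N>\min(\nu,\nu_\gamma)\text{ and } p^{\nu_{\min}}\mid\ell,\end{cases}\] where $\tilde n=Nnp^{ -2\nu_N}$.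
   Context: $U(N)$ denotes $\mathbb{Z}^2$ with quadratic form $Q(x,y)=Nxy$ (so $U(1)$ has $Q(x,y)=xy$), and its dual lattice is $\frac1N\mathbb{Z}^2$. For an even lattice $L$, $\gamma\in L'$, $n\in\mathbb{Z}-Q(\gamma)$ and a positive integer $a$, the representation number is $N^L_{\gamma,n}(a)=\#\{r\in L/aL: Q(r-\gamma)+n\equiv0\pmod a\}$. $p^e\,\|\,x$ means $p^e\mid x$ and $p^{e+1}\nmid x$. -}

module Defs where

open import Data.Nat as ℕ using (ℕ; _^_; _⊓_; suc)
open import Data.Integer as ℤ using (ℤ; +_; -[1+_]; 0ℤ)
open import Data.Integer.Divisibility.Signed using (_∣_; _∣?_)
open import Data.Integer.GCD using (gcd)
open import Data.Rational as ℚ using (ℚ)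
open import Data.Fin using (Fin; toℕ)
open import Data.List using (List; length; filter; allFin; cartesianProduct)
open import Data.Product using (_×_; _,_)
open import Data.Maybe using (Maybe; just; nothing)
open import Data.Empty using (⊥)
open import Relation.Nullary using (¬_; Dec)
open import Relation.Nullary.Decidable using (_×-dec_)
open import Relation.Binary.PropositionalEquality using (_≡_)

⟦_⟧ : ℤ → ℚ
⟦ z ⟧ = z ℚ./ 1

infixl 7 _/ℤ_
_/ℤ_ : ℤ → (N : ℤ) → .{{_ : ℤ.NonZero N}} → ℚ
a /ℤ (+ n)      = a ℚ./ n
a /ℤ (-[1+ n ]) = (ℤ.- a) ℚ./ suc n

Q : ℤ → ℚ × ℚ → ℚ
Q N (x , y) = ⟦ N ⟧ ℚ.* x ℚ.* y

-- "q ≡ 0 (mod a)" for a rational q: q is an integer divisible by a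
-- (q is stored in lowest terms, so q ∈ ℤ iff its denominator is 1)
ZeroMod : ℕ → ℚ → Set
ZeroMod a q = (ℚ.denominatorℕ q ≡ 1) × (+ a ∣ ℚ.numerator q)

zeroMod? : (a : ℕ) (q : ℚ) → Dec (ZeroMod a q)
zeroMod? a q = (ℚ.denominatorℕ q ℕ.≟ 1) ×-dec (+ a ∣? ℚ.numerator q)

-- Representation number N^{U(N)}_{γ,n}(a) = #{ r ∈ L/aL : Q(r - γ) + n ≡ 0 (mod a) },
-- with L = U(N) = ℤ², γ ∈ ℚ², n ∈ ℚ; L/aL is represented by {0,…,a-1}².
repNum : (N : ℤ) (γ : ℚ × ℚ) (n : ℚ) (a : ℕ) → ℕ
repNum N (g₁ , g₂) n a =
  length (filter (λ r → zeroMod? a (cond r)) (cartesianProduct (allFin a) (allFin a)))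
  where
  cond : Fin a × Fin a → ℚ
  cond (x , y) = Q N (⟦ + toℕ x ⟧ ℚ.- g₁ , ⟦ + toℕ y ⟧ ℚ.- g₂) ℚ.+ n

_∥_ : ℕ → ℤ → ℕ → Set
(p ∥ x) e = (+ (p ^ e) ∣ x) × ¬ (+ (p ^ suc e) ∣ x)

-- ν_γ ∈ ℕ ∪ {∞} (nothing = ∞): p^{ν_γ} ∥ gcd(γ₁,γ₂), and ν_γ = ∞ iff γ₁ = γ₂ = 0
IsNuGamma : ℕ → ℤ → ℤ → Maybe ℕ → Set
IsNuGamma p g₁ g₂ nothing  = (g₁ ≡ 0ℤ) × (g₂ ≡ 0ℤ)
IsNuGamma p g₁ g₂ (just e) = (p ∥ gcd g₁ g₂) e

minM : ℕ → Maybe ℕ → ℕ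
minM ν nothing  = ν
minM ν (just e) = ν ⊓ e

open import Data.Nat.Primality using (Prime; prime⇒nonZero)
open import Data.Nat.Properties using (m^n≢0)

prime^≢0 : ∀ {p} → Prime p → ∀ k → ℕ.NonZero (p ^ k)
prime^≢0 {p} pr k = m^n≢0 p k {{prime⇒nonZero pr}}

{-# OPTIONS --safe #-}
-- Clearing denominators, r = (x, y) is counted exactly when p^ν divides the integer
-- F(x, y) = N x y − γ₂ x − γ₁ y + ℓ.  If p^νmin, which divides p^ν, N, γ₁ and γ₂, does not divide ℓ,
-- F never vanishes mod p^ν.  If νN ≤ min(ν, ν_γ), then F = p^νN G with G = M x y − h₂ x − h₁ y + L,
-- p ∤ M, and G is periodic mod p^(ν − νN); this gives the factor p^(2νN), and the affine changes of
-- variables X = M x − h₁, Y = M y − h₂ (bijective because M is a unit) turn M G into X Y + (M L − h₁ h₂),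
-- the form counted by the U(1) term at ñ.  If min(ν, ν_γ) < νN, either p^ν divides every coefficient,
-- so all p^(2ν) pairs count, or ν_γ = s < ν and, say, p^(s+1) ∤ γ₁: then for each x the condition is
-- the linear congruence p^(ν − s) ∣ u y + d with u = (N x − γ₁)/p^s a unit, which has p^s solutions y.
module Submission where

module FiniteSums where
  open import Data.Nat.Base
  open import Data.Nat.Properties
  open import Data.Fin.Base using (Fin; toℕ; fromℕ<)
  open import Data.Fin.Properties using (toℕ<n; toℕ-fromℕ<; toℕ-injective)
  open import Data.Fin.Permutation using (permutation)
  import Algebra.Properties.CommutativeMonoid.Sum +-0-commutativeMonoid as FinSum
  open import Function.Base using (_∘_)
  open import Algebra.Properties.CommutativeSemigroup +-commutativeSemigroup using (interchange)
  open import Relation.Binary.PropositionalEquality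
  open ≡-Reasoning

  ∑< : ℕ → (ℕ → ℕ) → ℕ
  ∑< zero    f = 0
  ∑< (suc n) f = f 0 + ∑< n (f ∘ suc)

  infix 10 ∑<
  syntax ∑< n (λ i → x) = ∑[ i < n ] x

  ∑-cong : ∀ n {f g} → (∀ {i} → i < n → f i ≡ g i) → ∑< n f ≡ ∑< n g
  ∑-cong zero    f≗g = refl
  ∑-cong (suc n) f≗g = cong₂ _+_ (f≗g z<s) (∑-cong n (f≗g ∘ s<s))

  ∑-const : ∀ n c → ∑[ i < n ] c ≡ n * c
  ∑-const zero    c = refl
  ∑-const (suc n) c = cong (c +_) (∑-const n c)

  ∑-zero : ∀ n {f} → (∀ {i} → i < n → f i ≡ 0) → ∑< n f ≡ 0
  ∑-zero n f≗0 = trans (∑-cong n f≗0) (trans (∑-const n 0) (*-zeroʳ n))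

  ∑-split : ∀ m n f → ∑< (m + n) f ≡ ∑< m f + ∑[ i < n ] f (m + i)
  ∑-split zero    n f = refl
  ∑-split (suc m) n f = trans (cong (f 0 +_) (∑-split m n (f ∘ suc))) (sym (+-assoc (f 0) _ _))

  ∑-distrib-+ : ∀ n f g → ∑[ i < n ] (f i + g i) ≡ ∑< n f + ∑< n g
  ∑-distrib-+ zero    f g = refl
  ∑-distrib-+ (suc n) f g =
    trans (cong (f 0 + g 0 +_) (∑-distrib-+ n (f ∘ suc) (g ∘ suc))) (interchange (f 0) (g 0) _ _)

  ∑-distribˡ-* : ∀ n c f → ∑[ i < n ] (c * f i) ≡ c * ∑< n f
  ∑-distribˡ-* zero    c f = sym (*-zeroʳ c)
  ∑-distribˡ-* (suc n) c f =
    trans (cong (c * f 0 +_) (∑-distribˡ-* n c (f ∘ suc))) (sym (*-distribˡ-+ c (f 0) _))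

  ∑-comm : ∀ m n (g : ℕ → ℕ → ℕ) → ∑[ i < m ] ∑[ j < n ] g i j ≡ ∑[ j < n ] ∑[ i < m ] g i j
  ∑-comm zero    n g = sym (∑-zero n (λ _ → refl))
  ∑-comm (suc m) n g = begin
    ∑< n (g 0) + ∑[ i < m ] ∑[ j < n ] g (suc i) j   ≡⟨ cong (∑< n (g 0) +_) (∑-comm m n (g ∘ suc)) ⟩
    ∑< n (g 0) + ∑[ j < n ] ∑[ i < m ] g (suc i) j   ≡⟨ ∑-distrib-+ n (g 0) _ ⟨
    ∑[ j < n ] (g 0 j + ∑[ i < m ] g (suc i) j)      ∎

  ∑-periodic : ∀ k b f → (∀ i → f (b + i) ≡ f i) → ∑< (k * b) f ≡ k * ∑< b f
  ∑-periodic zero    b f f-per = refl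
  ∑-periodic (suc k) b f f-per = begin
    ∑< (b + k * b) f                      ≡⟨ ∑-split b (k * b) f ⟩
    ∑< b f + ∑[ i < k * b ] f (b + i)     ≡⟨ cong (∑< b f +_) (∑-cong (k * b) (λ {i} _ → f-per i)) ⟩
    ∑< b f + ∑< (k * b) f                 ≡⟨ cong (∑< b f +_) (∑-periodic k b f f-per) ⟩
    ∑< b f + k * ∑< b f                   ∎

  record IsPermutation (n : ℕ) (σ : ℕ → ℕ) : Set where
    field
      inverse   : ℕ → ℕ
      σ-<       : ∀ {i} → i < n → σ i < n
      inverse-< : ∀ {i} → i < n → inverse i < n
      inverseˡ  : ∀ {i} → i < n → inverse (σ i) ≡ i
      inverseʳ  : ∀ {i} → i < n → σ (inverse i) ≡ i

  ∑≡sum : ∀ n f → ∑< n f ≡ FinSum.sum {n} (f ∘ toℕ)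
  ∑≡sum zero    f = refl
  ∑≡sum (suc n) f = cong (f 0 +_) (∑≡sum n (f ∘ suc))

  ∑-permute : ∀ {n σ} → IsPermutation n σ → ∀ f → ∑[ i < n ] f (σ i) ≡ ∑< n f
  ∑-permute {n} {σ} σ-perm f = begin
    ∑[ i < n ] f (σ i)              ≡⟨ ∑≡sum n (f ∘ σ) ⟩
    FinSum.sum {n} (f ∘ σ ∘ toℕ)    ≡⟨ FinSum.sum-cong-≗ {n} (λ i → cong f (toℕ-fromℕ< (σ-< (toℕ<n i)))) ⟨
    FinSum.sum {n} (f ∘ toℕ ∘ σᶠ)   ≡⟨ FinSum.sum-permute (f ∘ toℕ) π ⟨
    FinSum.sum {n} (f ∘ toℕ)        ≡⟨ ∑≡sum n f ⟨
    ∑< n f                          ∎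
    where
    open IsPermutation σ-perm
    σᶠ τᶠ : Fin n → Fin n
    σᶠ i = fromℕ< (σ-< (toℕ<n i))
    τᶠ i = fromℕ< (inverse-< (toℕ<n i))
    π = permutation σᶠ τᶠ
      (λ i → toℕ-injective (trans (toℕ-fromℕ< _) (trans (cong σ (toℕ-fromℕ< _)) (inverseʳ (toℕ<n i)))))
      (λ i → toℕ-injective (trans (toℕ-fromℕ< _) (trans (cong inverse (toℕ-fromℕ< _)) (inverseˡ (toℕ<n i)))))

module Counting where
  open FiniteSums
  open import Level using (Level)
  open import Data.Nat.Base using (ℕ; zero; suc; _+_)
  open import Data.Fin.Base as Fin using (Fin; toℕ)
  open import Data.List.Base using ([]; _∷_; _++_; length; filter; map; tabulate; allFin; cartesianProduct)
  open import Data.List.Properties using (filter-++; length-++)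
  open import Data.Product.Base using (_×_; _,_)
  open import Function.Base using (_∘_)
  open import Function.Bundles using (_⇔_; module Equivalence)
  open import Relation.Nullary using (Dec; yes; no; ¬_; contradiction)
  open import Relation.Unary using (Pred; Decidable)
  open import Relation.Binary.PropositionalEquality

  private variable
    a b p : Level
    A : Set a
    B : Set b

  𝟙[_] : Dec A → ℕ
  𝟙[ yes _ ] = 1
  𝟙[ no  _ ] = 0

  𝟙-yes : (a? : Dec A) → A → 𝟙[ a? ] ≡ 1
  𝟙-yes (yes _) _ = refl
  𝟙-yes (no ¬a) a = contradiction a ¬a

  𝟙-no : (a? : Dec A) → ¬ A → 𝟙[ a? ] ≡ 0
  𝟙-no (yes a) ¬a = contradiction a ¬a
  𝟙-no (no _)  _  = refl

  𝟙-⇔ : A ⇔ B → (a? : Dec A) (b? : Dec B) → 𝟙[ a? ] ≡ 𝟙[ b? ]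
  𝟙-⇔ A⇔B a? (yes b) = 𝟙-yes a? (Equivalence.from A⇔B b)
  𝟙-⇔ A⇔B a? (no ¬b) = 𝟙-no a? (¬b ∘ Equivalence.to A⇔B)

  module _ {P : Pred A p} (P? : Decidable P) where

    length-filter-map : ∀ (f : B → A) xs → length (filter P? (map f xs)) ≡ length (filter (P? ∘ f) xs)
    length-filter-map f []       = refl
    length-filter-map f (x ∷ xs) with P? (f x)
    ... | yes _ = cong suc (length-filter-map f xs)
    ... | no  _ = length-filter-map f xs

    count-tabulate : ∀ {n} (t : Fin n → A) (h : ℕ → ℕ) → (∀ i → 𝟙[ P? (t i) ] ≡ h (toℕ i)) →
                     length (filter P? (tabulate t)) ≡ ∑< n h
    count-tabulate {zero}  t h eq = refl
    count-tabulate {suc n} t h eq with P? (t Fin.zero) | eq Fin.zero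
    ... | yes _ | h0≡1 = cong₂ _+_ h0≡1 (count-tabulate (t ∘ Fin.suc) (h ∘ suc) (eq ∘ Fin.suc))
    ... | no  _ | h0≡0 = cong₂ _+_ h0≡0 (count-tabulate (t ∘ Fin.suc) (h ∘ suc) (eq ∘ Fin.suc))

  count-cartesianProduct : ∀ {P : Pred (A × B) p} (P? : Decidable P) {m} (s : Fin m → A) ys (h : ℕ → ℕ) →
    (∀ i → length (filter (λ y → P? (s i , y)) ys) ≡ h (toℕ i)) →
    length (filter P? (cartesianProduct (tabulate s) ys)) ≡ ∑< m h
  count-cartesianProduct P? {zero}  s ys h eq = refl
  count-cartesianProduct P? {suc m} s ys h eq = begin
    length (filter P? (map (s Fin.zero ,_) ys ++ cartesianProduct (tabulate (s ∘ Fin.suc)) ys))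
      ≡⟨ cong length (filter-++ P? (map (s Fin.zero ,_) ys) _) ⟩
    length (filter P? (map (s Fin.zero ,_) ys) ++ filter P? (cartesianProduct (tabulate (s ∘ Fin.suc)) ys))
      ≡⟨ length-++ (filter P? (map (s Fin.zero ,_) ys)) ⟩
    length (filter P? (map (s Fin.zero ,_) ys)) + length (filter P? (cartesianProduct (tabulate (s ∘ Fin.suc)) ys))
      ≡⟨ cong₂ _+_ (trans (length-filter-map P? (s Fin.zero ,_) ys) (eq Fin.zero))
                   (count-cartesianProduct P? (s ∘ Fin.suc) ys (h ∘ suc) (eq ∘ Fin.suc)) ⟩
    h 0 + ∑< m (h ∘ suc)
      ∎
    where open ≡-Reasoning

  count-allFin² : ∀ n {P : Pred (Fin n × Fin n) p} (P? : Decidable P) (h : ℕ → ℕ → ℕ) →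
    (∀ i j → 𝟙[ P? (i , j) ] ≡ h (toℕ i) (toℕ j)) →
    length (filter P? (cartesianProduct (allFin n) (allFin n))) ≡ ∑[ i < n ] ∑[ j < n ] h i j
  count-allFin² n P? h eq =
    count-cartesianProduct P? _ (allFin n) (λ i → ∑< n (h i))
      (λ i → count-tabulate (λ y → P? (i , y)) _ (h (toℕ i)) (eq i))

module ModularArithmetic where
  open FiniteSums
  open Counting
  open import Data.Nat.Base as ℕ using (ℕ; zero; suc; _<_; _^_; NonZero; s<s)
  import Data.Nat.Properties as ℕP
  open import Data.Nat.Divisibility as ℕ using () renaming (_∣_ to _∣ℕ_)
  open import Data.Nat.Coprimality using (Coprime; coprime-Bézout; coprime-divisor; 1-coprimeTo)
  open import Data.Nat.GCD using (module Bézout)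
  open import Data.Nat.Primality using (Prime; prime⇒irreducible)
  open import Data.Integer.Base using (ℤ; +_; -[1+_]; _+_; _*_; _-_; -_; ∣_∣; 0ℤ; 1ℤ; _%ℕ_; _/ℕ_)
  import Data.Integer.Properties as ℤP
  open import Data.Integer.Divisibility.Signed
  open import Data.Integer.DivMod using (a≡a%ℕn+[a/ℕn]*n; n%ℕd<d)
  open import Data.Integer.Tactic.RingSolver using (solve-∀)
  open import Data.Product.Base using (_,_)
  open import Data.Sum.Base using (inj₁; inj₂)
  open import Function.Base using (_∘_; _$_)
  open import Function.Bundles using (mk⇔)
  open import Relation.Binary.Bundles using (Setoid)
  import Relation.Binary.Reasoning.Setoid
  open import Relation.Binary.Structures using (IsEquivalence)
  open import Relation.Nullary using (¬_; contradiction)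
  open import Relation.Binary.PropositionalEquality

  infix 4 _≡_mod_
  record _≡_mod_ (i j : ℤ) (B : ℕ) : Set where
    constructor ≡mod
    field modulus∣difference : + B ∣ i - j

  module _ {B : ℕ} where

    ≡mod-reflexive : ∀ {i j} → i ≡ j → i ≡ j mod B
    ≡mod-reflexive {i} refl = ≡mod (subst (+ B ∣_) (sym (ℤP.+-inverseʳ i)) (divides 0ℤ refl))

    ≡mod-refl : ∀ {i} → i ≡ i mod B
    ≡mod-refl = ≡mod-reflexive refl

    ≡mod-sym : ∀ {i j} → i ≡ j mod B → j ≡ i mod B
    ≡mod-sym {i} {j} (≡mod d) = ≡mod (subst (+ B ∣_) (negate i j) (∣m⇒∣-m d))
      where negate : ∀ i j → - (i - j) ≡ j - i
            negate = solve-∀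

    ≡mod-trans : ∀ {i j k} → i ≡ j mod B → j ≡ k mod B → i ≡ k mod B
    ≡mod-trans {i} {j} {k} (≡mod d) (≡mod e) = ≡mod (subst (+ B ∣_) (telescope i j k) (∣m∣n⇒∣m+n d e))
      where telescope : ∀ i j k → (i - j) + (j - k) ≡ i - k
            telescope = solve-∀

    ≡mod-isEquivalence : IsEquivalence (λ i j → i ≡ j mod B)
    ≡mod-isEquivalence = record { refl = ≡mod-refl ; sym = ≡mod-sym ; trans = ≡mod-trans }

    +-cong-mod : ∀ {i j k l} → i ≡ j mod B → k ≡ l mod B → i + k ≡ j + l mod B
    +-cong-mod {i} {j} {k} {l} (≡mod d) (≡mod e) = ≡mod (subst (+ B ∣_) (regroup i j k l) (∣m∣n⇒∣m+n d e))
      where regroup : ∀ i j k l → (i - j) + (k - l) ≡ (i + k) - (j + l)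
            regroup = solve-∀

    *-cong-mod : ∀ {i j k l} → i ≡ j mod B → k ≡ l mod B → i * k ≡ j * l mod B
    *-cong-mod {i} {j} {k} {l} (≡mod d) (≡mod e) =
      ≡mod (subst (+ B ∣_) (regroup i j k l) (∣m∣n⇒∣m+n (∣m⇒∣m*n k d) (∣n⇒∣m*n j e)))
      where regroup : ∀ i j k l → (i - j) * k + j * (k - l) ≡ i * k - j * l
            regroup = solve-∀

    -‿cong-mod : ∀ {i j} → i ≡ j mod B → - i ≡ - j mod B
    -‿cong-mod {i} {j} (≡mod d) = ≡mod (subst (+ B ∣_) (negate i j) (∣m⇒∣-m d))
      where negate : ∀ i j → - (i - j) ≡ - i - - j
            negate = solve-∀

    +-congʳ-mod : ∀ k {i j} → i ≡ j mod B → i + k ≡ j + k mod B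
    +-congʳ-mod k i≡j = +-cong-mod i≡j ≡mod-refl

    *-congˡ-mod : ∀ k {i j} → i ≡ j mod B → k * i ≡ k * j mod B
    *-congˡ-mod k i≡j = *-cong-mod (≡mod-refl {k}) i≡j

    *-congʳ-mod : ∀ k {i j} → i ≡ j mod B → i * k ≡ j * k mod B
    *-congʳ-mod k i≡j = *-cong-mod i≡j (≡mod-refl {k})

    ∣-resp-≡mod : ∀ {i j} → i ≡ j mod B → + B ∣ j → + B ∣ i
    ∣-resp-≡mod {i} {j} (≡mod d) B∣j = subst (+ B ∣_) (cancel i j) (∣m∣n⇒∣m+n d B∣j)
      where cancel : ∀ i j → (i - j) + j ≡ i
            cancel = solve-∀

    𝟙∣-cong : ∀ {i j} → i ≡ j mod B → 𝟙[ + B ∣? i ] ≡ 𝟙[ + B ∣? j ]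
    𝟙∣-cong i≡j = 𝟙-⇔ (mk⇔ (∣-resp-≡mod (≡mod-sym i≡j)) (∣-resp-≡mod i≡j)) _ _

    +-shift-mod : ∀ x → + (B ℕ.+ x) ≡ + x mod B
    +-shift-mod x = ≡mod (divides 1ℤ (trans (cong (_- + x) (ℤP.pos-+ B x)) (cancel (+ B) (+ x))))
      where cancel : ∀ b x → (b + x) - x ≡ 1ℤ * b
            cancel = solve-∀

    %ℕ-≡mod : ∀ .{{_ : NonZero B}} i → + (i %ℕ B) ≡ i mod B
    %ℕ-≡mod i = ≡mod (divides (- (i /ℕ B))
      (trans (cong (λ t → + (i %ℕ B) - t) (a≡a%ℕn+[a/ℕn]*n i B)) (cancel (+ (i %ℕ B)) (i /ℕ B) (+ B))))
      where cancel : ∀ r q b → r - (r + q * b) ≡ - q * b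
            cancel = solve-∀

    ≡mod⇒≡ : ∀ {x y} → x < B → y < B → + x ≡ + y mod B → x ≡ y
    ≡mod⇒≡ {x} {y} x<B y<B (≡mod d) =
      ℤP.+-injective (ℤP.i-j≡0⇒i≡j (+ x) (+ y) (ℤP.∣i∣≡0⇒i≡0 (small-multiple-is-0 B∣diff diff<B)))
      where
      B∣diff : B ∣ℕ ∣ + x - + y ∣
      B∣diff = ∣⇒∣ᵤ d
      diff<B : ∣ + x - + y ∣ < B
      diff<B = subst (_< B) (cong ∣_∣ (sym (ℤP.m-n≡m⊖n x y)))
                     (ℕP.≤-<-trans (ℤP.∣m⊝n∣≤m⊔n x y) (ℕP.⊔-pres-<m x<B y<B))
      small-multiple-is-0 : ∀ {n} → B ∣ℕ n → n < B → n ≡ 0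
      small-multiple-is-0 {zero}  _   _   = refl
      small-multiple-is-0 {suc n} B∣n n<B = contradiction B∣n (ℕ.>⇒∤ n<B)

  ≡mod-setoid : ℕ → Setoid _ _
  ≡mod-setoid B = record { isEquivalence = ≡mod-isEquivalence {B} }

  module ≡mod-Reasoning B = Relation.Binary.Reasoning.Setoid (≡mod-setoid B)

  record Invertible (B : ℕ) (u : ℤ) : Set where
    constructor invertible
    field
      inverse  : ℤ
      inverseʳ : u * inverse ≡ 1ℤ mod B

  invertible-neg : ∀ {B u} → Invertible B u → Invertible B (- u)
  invertible-neg {B} {u} (invertible w uw≡1) =
    invertible (- w) (≡mod-trans (≡mod-reflexive (neg-neg u w)) uw≡1)
    where neg-neg : ∀ u w → - u * - w ≡ u * w
          neg-neg = solve-∀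

  pos-1+* : ∀ a b → + (1 ℕ.+ a ℕ.* b) ≡ 1ℤ + + a * + b
  pos-1+* a b = trans (ℤP.pos-+ 1 (a ℕ.* b)) (cong (λ t → 1ℤ + t) (ℤP.pos-* a b))

  coprime⇒invertible : ∀ {B u} → Coprime B ∣ u ∣ → Invertible B u
  coprime⇒invertible {B} {+ m}      c with coprime-Bézout c
  ... | Bézout.+- x y eq = invertible (- + y) $ ≡mod $ divides (- + x) (begin
    + m * - + y - 1ℤ           ≡⟨ negated (+ m) (+ y) ⟩
    - (1ℤ + + y * + m)         ≡⟨ cong -_ (pos-1+* y m) ⟨
    - + (1 ℕ.+ y ℕ.* m)        ≡⟨ cong (-_ ∘ +_) eq ⟩
    - + (x ℕ.* B)              ≡⟨ cong -_ (ℤP.pos-* x B) ⟩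
    - (+ x * + B)              ≡⟨ ℤP.neg-distribˡ-* (+ x) (+ B) ⟩
    - + x * + B                ∎)
    where
    open ≡-Reasoning
    negated : ∀ m y → m * - y - 1ℤ ≡ - (1ℤ + y * m)
    negated = solve-∀
  ... | Bézout.-+ x y eq = invertible (+ y) $ ≡mod $ divides (+ x) (begin
    + m * + y - 1ℤ             ≡⟨ cong (_- 1ℤ) (ℤP.*-comm (+ m) (+ y)) ⟩
    + y * + m - 1ℤ             ≡⟨ cong (_- 1ℤ) (ℤP.pos-* y m) ⟨
    + (y ℕ.* m) - 1ℤ           ≡⟨ cong (λ t → + t - 1ℤ) eq ⟨
    + (1 ℕ.+ x ℕ.* B) - 1ℤ     ≡⟨ cong (_- 1ℤ) (pos-1+* x B) ⟩
    1ℤ + + x * + B - 1ℤ        ≡⟨ cancel 1ℤ (+ x * + B) ⟩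
    + x * + B                  ∎)
    where
    open ≡-Reasoning
    cancel : ∀ a b → a + b - a ≡ b
    cancel = solve-∀
  coprime⇒invertible {B} { -[1+ n ]} c = invertible-neg {u = + suc n} (coprime⇒invertible {u = + suc n} c)

  invertible-cancelˡ : ∀ {B u z} → Invertible B u → + B ∣ u * z → + B ∣ z
  invertible-cancelˡ {B} {u} {z} (invertible w uw≡1) B∣uz = ∣-resp-≡mod z≡w[uz] (∣n⇒∣m*n w B∣uz)
    where
    open ≡mod-Reasoning B
    z≡w[uz] : z ≡ w * (u * z) mod B
    z≡w[uz] = begin
      z              ≡⟨ ℤP.*-identityˡ z ⟨
      1ℤ * z         ≈⟨ *-congʳ-mod z (≡mod-sym uw≡1) ⟩
      u * w * z      ≡⟨ reassoc u w z ⟩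
      w * (u * z)    ∎
      where reassoc : ∀ u w z → u * w * z ≡ w * (u * z)
            reassoc = solve-∀

  prime∤⇒coprime-^ : ∀ {p m} → Prime p → ¬ p ∣ℕ m → ∀ k → Coprime (p ^ k) m
  prime∤⇒coprime-^ {p} {m} pr p∤m zero    = 1-coprimeTo m
  prime∤⇒coprime-^ {p} {m} pr p∤m (suc k) {i} (i∣p^[1+k] , i∣m) =
    prime∤⇒coprime-^ pr p∤m k (coprime-divisor i⊥p i∣p^[1+k] , i∣m)
    where
    i⊥p : Coprime i p
    i⊥p {j} (j∣i , j∣p) with prime⇒irreducible pr j∣p
    ... | inj₁ j≡1 = j≡1
    ... | inj₂ refl = contradiction (ℕ.∣-trans j∣i i∣m) p∤m

  prime∤⇒invertible : ∀ {p u} → Prime p → ¬ + p ∣ u → ∀ k → Invertible (p ^ k) u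
  prime∤⇒invertible pr p∤u k = coprime⇒invertible (prime∤⇒coprime-^ pr (p∤u ∘ ∣ᵤ⇒∣) k)

  ∑-𝟙∣ : ∀ B .{{_ : NonZero B}} → ∑[ z < B ] 𝟙[ + B ∣? + z ] ≡ 1
  ∑-𝟙∣ (suc n) = cong₂ ℕ._+_ (𝟙-yes (+ suc n ∣? 0ℤ) (divides 0ℤ refl))
    (∑-zero n λ {z} z<n → 𝟙-no (+ suc n ∣? + suc z) (ℕ.>⇒∤ (s<s z<n) ∘ ∣⇒∣ᵤ))

  module _ {B : ℕ} .{{_ : NonZero B}} where

    affine-isPermutation : ∀ {u} → Invertible B u → ∀ c → IsPermutation B (λ x → (u * + x + c) %ℕ B)
    affine-isPermutation {u} (invertible w uw≡1) c = record
      { inverse   = τ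
      ; σ-<       = λ {x} _ → n%ℕd<d (u * + x + c) B
      ; inverse-< = λ {z} _ → n%ℕd<d (w * (+ z - c)) B
      ; inverseˡ  = λ {x} x<B → ≡mod⇒≡ (n%ℕd<d (w * (+ σ x - c)) B) x<B (τσ≡id x)
      ; inverseʳ  = λ {z} z<B → ≡mod⇒≡ (n%ℕd<d (u * + τ z + c) B) z<B (στ≡id z)
      }
      where
      open ≡mod-Reasoning B
      σ τ : ℕ → ℕ
      σ x = (u * + x + c) %ℕ B
      τ z = (w * (+ z - c)) %ℕ B
      τσ≡id : ∀ x → + τ (σ x) ≡ + x mod B
      τσ≡id x = begin
        + τ (σ x)                  ≈⟨ %ℕ-≡mod (w * (+ σ x - c)) ⟩
        w * (+ σ x - c)            ≈⟨ *-congˡ-mod w (+-congʳ-mod (- c) (%ℕ-≡mod (u * + x + c))) ⟩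
        w * (u * + x + c - c)      ≡⟨ regroup w u (+ x) c ⟩
        (u * w) * + x              ≈⟨ *-congʳ-mod (+ x) uw≡1 ⟩
        1ℤ * + x                   ≡⟨ ℤP.*-identityˡ (+ x) ⟩
        + x                        ∎
        where regroup : ∀ w u x c → w * (u * x + c - c) ≡ (u * w) * x
              regroup = solve-∀
      στ≡id : ∀ z → + σ (τ z) ≡ + z mod B
      στ≡id z = begin
        + σ (τ z)                  ≈⟨ %ℕ-≡mod (u * + τ z + c) ⟩
        u * + τ z + c              ≈⟨ +-congʳ-mod c (*-congˡ-mod u (%ℕ-≡mod (w * (+ z - c)))) ⟩
        u * (w * (+ z - c)) + c    ≡⟨ regroup u w (+ z) c ⟩
        (u * w) * (+ z - c) + c    ≈⟨ +-congʳ-mod c (*-congʳ-mod (+ z - c) uw≡1) ⟩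
        1ℤ * (+ z - c) + c         ≡⟨ cancel (+ z) c ⟩
        + z                        ∎
        where regroup : ∀ u w z c → u * (w * (z - c)) + c ≡ (u * w) * (z - c) + c
              regroup = solve-∀
              cancel : ∀ z c → 1ℤ * (z - c) + c ≡ z
              cancel = solve-∀

    ∑-𝟙∣-linear : ∀ {u} → Invertible B u → ∀ c → ∑[ y < B ] 𝟙[ + B ∣? u * + y + c ] ≡ 1
    ∑-𝟙∣-linear {u} u⁻¹ c = begin
      ∑[ y < B ] 𝟙[ + B ∣? u * + y + c ]
        ≡⟨ ∑-cong B (λ {y} _ → 𝟙∣-cong (≡mod-sym (%ℕ-≡mod (u * + y + c)))) ⟩
      ∑[ y < B ] 𝟙[ + B ∣? + ((u * + y + c) %ℕ B) ]
        ≡⟨ ∑-permute (affine-isPermutation u⁻¹ c) (λ z → 𝟙[ + B ∣? + z ]) ⟩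
      ∑[ z < B ] 𝟙[ + B ∣? + z ]
        ≡⟨ ∑-𝟙∣ B ⟩
      1 ∎
      where open ≡-Reasoning

  𝟙∣-cancelˡ : ∀ c {B} .{{_ : NonZero c}} z → 𝟙[ + (c ℕ.* B) ∣? + c * z ] ≡ 𝟙[ + B ∣? z ]
  𝟙∣-cancelˡ c {B} z = 𝟙-⇔ (mk⇔ (*-cancelˡ-∣ (+ c) ∘ subst (_∣ + c * z) (ℤP.pos-* c B))
                                 (subst (_∣ + c * z) (sym (ℤP.pos-* c B)) ∘ *-monoʳ-∣ (+ c))) _ _

  ∑-𝟙∣-scaled-linear : ∀ {B} .{{_ : NonZero B}} {u} → Invertible B u → ∀ c .{{_ : NonZero c}} d →
    ∑[ y < c ℕ.* B ] 𝟙[ + (c ℕ.* B) ∣? + c * (u * + y + d) ] ≡ c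
  ∑-𝟙∣-scaled-linear {B} {u} u⁻¹ c d = begin
    ∑[ y < c ℕ.* B ] 𝟙[ + (c ℕ.* B) ∣? + c * (u * + y + d) ]
      ≡⟨ ∑-cong (c ℕ.* B) (λ {y} _ → 𝟙∣-cancelˡ c (u * + y + d)) ⟩
    ∑[ y < c ℕ.* B ] 𝟙[ + B ∣? u * + y + d ]
      ≡⟨ ∑-periodic c B _ (λ y → 𝟙∣-cong (+-congʳ-mod d (*-congˡ-mod u (+-shift-mod y)))) ⟩
    c ℕ.* ∑[ y < B ] 𝟙[ + B ∣? u * + y + d ]
      ≡⟨ cong (c ℕ.*_) (∑-𝟙∣-linear u⁻¹ d) ⟩
    c ℕ.* 1
      ≡⟨ ℕP.*-identityʳ c ⟩
    c ∎
    where open ≡-Reasoning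

module SolutionCounts where
  open FiniteSums
  open Counting
  open ModularArithmetic
  open import Defs using (prime^≢0)
  open import Data.Nat.Base as ℕ using (ℕ; suc; _^_; NonZero)
  import Data.Nat.Properties as ℕP
  open import Data.Nat.Primality using (Prime)
  open import Data.Integer.Base using (ℤ; +_; _+_; _*_; _-_; -_; 0ℤ; 1ℤ; _%ℕ_)
  import Data.Integer.Properties as ℤP
  open import Data.Integer.Divisibility.Signed
  open import Data.Integer.Tactic.RingSolver using (solve-∀)
  open import Data.Product.Base using (_×_; _,_)
  open import Function.Base using (_∘_)
  open import Function.Bundles using (_⇔_; mk⇔; module Equivalence)
  open import Relation.Nullary using (¬_; yes; no)
  open import Relation.Binary.PropositionalEquality

  #solutions : ℕ → (ℤ → ℤ → ℤ) → ℕ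
  #solutions a F = ∑[ x < a ] ∑[ y < a ] 𝟙[ + a ∣? F (+ x) (+ y) ]

  -- Q(r − γ) + n at r = (X, Y), for γ = (g₁/N, g₂/N) and n = ℓ − g₁g₂/N, with the denominators cleared.
  shiftedForm : ℤ → ℤ → ℤ → ℤ → ℤ → ℤ → ℤ
  shiftedForm N g₁ g₂ ℓ X Y = N * X * Y - X * g₂ - Y * g₁ + ℓ

  shiftedForm-cong : ∀ {B} N g₁ g₂ ℓ {X X′ Y Y′} → X ≡ X′ mod B → Y ≡ Y′ mod B →
                     shiftedForm N g₁ g₂ ℓ X Y ≡ shiftedForm N g₁ g₂ ℓ X′ Y′ mod B
  shiftedForm-cong N g₁ g₂ ℓ X≡X′ Y≡Y′ = +-congʳ-mod ℓ
    (+-cong-mod (+-cong-mod (*-cong-mod (*-congˡ-mod N X≡X′) Y≡Y′) (-‿cong-mod (*-congʳ-mod g₂ X≡X′)))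
                (-‿cong-mod (*-congʳ-mod g₁ Y≡Y′)))

  shiftedForm-∣⇔ : ∀ {d N g₁ g₂} ℓ → d ∣ N → d ∣ g₁ → d ∣ g₂ → ∀ X Y →
                   d ∣ shiftedForm N g₁ g₂ ℓ X Y ⇔ d ∣ ℓ
  shiftedForm-∣⇔ ℓ d∣N d∣g₁ d∣g₂ X Y = mk⇔ (λ d∣F → ∣m+n∣m⇒∣n d∣F d∣nonconstant) (∣m∣n⇒∣m+n d∣nonconstant)
    where
    d∣nonconstant = ∣m∣n⇒∣m-n (∣m∣n⇒∣m-n (∣m⇒∣m*n Y (∣m⇒∣m*n X d∣N)) (∣n⇒∣m*n X d∣g₂)) (∣n⇒∣m*n Y d∣g₁)

  #solutions-≡0 : ∀ {d a N g₁ g₂ ℓ} → d ∣ + a → d ∣ N → d ∣ g₁ → d ∣ g₂ → ¬ d ∣ ℓ →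
                  #solutions a (shiftedForm N g₁ g₂ ℓ) ≡ 0
  #solutions-≡0 {d} {a} {N} {g₁} {g₂} {ℓ} d∣a d∣N d∣g₁ d∣g₂ d∤ℓ = ∑-zero a λ {x} _ → ∑-zero a λ {y} _ →
    𝟙-no (+ a ∣? _) (d∤ℓ ∘ Equivalence.to (shiftedForm-∣⇔ ℓ d∣N d∣g₁ d∣g₂ (+ x) (+ y)) ∘ ∣-trans d∣a)

  #solutions-all : ∀ {a N g₁ g₂ ℓ} → + a ∣ N → + a ∣ g₁ → + a ∣ g₂ → + a ∣ ℓ →
                   #solutions a (shiftedForm N g₁ g₂ ℓ) ≡ a ℕ.* a
  #solutions-all {a} {N} {g₁} {g₂} {ℓ} a∣N a∣g₁ a∣g₂ a∣ℓ = begin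
    #solutions a (shiftedForm N g₁ g₂ ℓ)
      ≡⟨ ∑-cong a (λ _ → ∑-cong a λ _ →
           𝟙-yes (+ a ∣? _) (Equivalence.from (shiftedForm-∣⇔ ℓ a∣N a∣g₁ a∣g₂ _ _) a∣ℓ)) ⟩
    ∑[ x < a ] ∑[ y < a ] 1
      ≡⟨ ∑-cong a (λ _ → trans (∑-const a 1) (ℕP.*-identityʳ a)) ⟩
    ∑[ x < a ] a
      ≡⟨ ∑-const a a ⟩
    a ℕ.* a ∎
    where open ≡-Reasoning

  #solutions-swap : ∀ a N g₁ g₂ ℓ → #solutions a (shiftedForm N g₁ g₂ ℓ) ≡ #solutions a (shiftedForm N g₂ g₁ ℓ)
  #solutions-swap a N g₁ g₂ ℓ =
    trans (∑-comm a a _) (∑-cong a λ {y} _ → ∑-cong a λ {x} _ →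
      cong (𝟙[_] ∘ (+ a ∣?_)) (transpose N g₁ g₂ ℓ (+ x) (+ y)))
    where transpose : ∀ N g₁ g₂ ℓ X Y → N * X * Y - X * g₂ - Y * g₁ + ℓ ≡ N * Y * X - Y * g₁ - X * g₂ + ℓ
          transpose = solve-∀

  #solutions-columns : ∀ a F {c} → (∀ x → ∑[ y < a ] 𝟙[ + a ∣? F (+ x) (+ y) ] ≡ c) → #solutions a F ≡ a ℕ.* c
  #solutions-columns a F {c} column = trans (∑-cong a λ {x} _ → column x) (∑-const a c)

  ∑-𝟙∣-column : ∀ {p} → Prime p → ∀ s k {N g₁ g₂ ℓ} → + (p ^ suc s) ∣ N → + (p ^ s) ∣ g₁ → ¬ + (p ^ suc s) ∣ g₁ →
    + (p ^ s) ∣ g₂ → + (p ^ s) ∣ ℓ → ∀ x →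
    ∑[ y < p ^ s ℕ.* p ^ k ] 𝟙[ + (p ^ s ℕ.* p ^ k) ∣? shiftedForm N g₁ g₂ ℓ (+ x) (+ y) ] ≡ p ^ s
  ∑-𝟙∣-column {p} pr s k (divides N′ refl) (divides G₁ refl) p^[1+s]∤g₁ (divides G₂ refl) (divides L refl) x =
    trans (∑-cong (p ^ s ℕ.* p ^ k) λ {y} _ → cong (𝟙[_] ∘ (+ (p ^ s ℕ.* p ^ k) ∣?_)) (factor y))
          (∑-𝟙∣-scaled-linear {{prime^≢0 pr k}} (prime∤⇒invertible pr p∤u k) (p ^ s) {{prime^≢0 pr s}} (L - + x * G₂))
    where
    P = + (p ^ s)
    u = N′ * + p * + x - G₁
    factor : ∀ y → shiftedForm (N′ * + (p ^ suc s)) (G₁ * P) (G₂ * P) (L * P) (+ x) (+ y) ≡ P * (u * + y + (L - + x * G₂))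
    factor y = trans (cong (λ q → shiftedForm (N′ * q) (G₁ * P) (G₂ * P) (L * P) (+ x) (+ y)) (ℤP.pos-* p (p ^ s)))
                     (factorise N′ (+ p) P G₁ G₂ L (+ x) (+ y))
      where factorise : ∀ N′ p P G₁ G₂ L X Y →
              N′ * (p * P) * X * Y - X * (G₂ * P) - Y * (G₁ * P) + L * P ≡ P * ((N′ * p * X - G₁) * Y + (L - X * G₂))
            factorise = solve-∀
    p∤u : ¬ + p ∣ u
    p∤u (divides q u≡qp) = p^[1+s]∤g₁ (divides (N′ * + x - q) (begin
      G₁ * P                       ≡⟨ cong (_* P) (solve-G₁ N′ (+ p) (+ x) G₁) ⟩
      (N′ * + p * + x - u) * P     ≡⟨ cong (λ v → (N′ * + p * + x - v) * P) u≡qp ⟩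
      (N′ * + p * + x - q * + p) * P ≡⟨ regroup N′ (+ p) (+ x) q P ⟩
      (N′ * + x - q) * (+ p * P)   ≡⟨ cong ((N′ * + x - q) *_) (ℤP.pos-* p (p ^ s)) ⟨
      (N′ * + x - q) * + (p ^ suc s) ∎))
      where
      open ≡-Reasoning
      solve-G₁ : ∀ N′ p X G₁ → G₁ ≡ N′ * p * X - (N′ * p * X - G₁)
      solve-G₁ = solve-∀
      regroup : ∀ N′ p X q P → (N′ * p * X - q * p) * P ≡ (N′ * X - q) * (p * P)
      regroup = solve-∀

  #solutions-exact : ∀ {p} → Prime p → ∀ s k {N g₁ g₂ ℓ} → + (p ^ suc s) ∣ N → + (p ^ s) ∣ g₁ → + (p ^ s) ∣ g₂ →
    ¬ (+ (p ^ suc s) ∣ g₁ × + (p ^ suc s) ∣ g₂) → + (p ^ s) ∣ ℓ →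
    #solutions (p ^ s ℕ.* p ^ k) (shiftedForm N g₁ g₂ ℓ) ≡ p ^ s ℕ.* p ^ k ℕ.* p ^ s
  #solutions-exact {p} pr s k {N} {g₁} {g₂} {ℓ} p^[1+s]∣N p^s∣g₁ p^s∣g₂ ¬both p^s∣ℓ with + (p ^ suc s) ∣? g₁
  ... | no  p^[1+s]∤g₁ = #solutions-columns (p ^ s ℕ.* p ^ k) (shiftedForm N g₁ g₂ ℓ)
    (∑-𝟙∣-column pr s k p^[1+s]∣N p^s∣g₁ p^[1+s]∤g₁ p^s∣g₂ p^s∣ℓ)
  ... | yes p^[1+s]∣g₁ = trans (#solutions-swap (p ^ s ℕ.* p ^ k) N g₁ g₂ ℓ)
    (#solutions-columns (p ^ s ℕ.* p ^ k) (shiftedForm N g₂ g₁ ℓ)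
      (∑-𝟙∣-column pr s k p^[1+s]∣N p^s∣g₂ (¬both ∘ (p^[1+s]∣g₁ ,_)) p^s∣g₁ p^s∣ℓ))

  #solutions-scale : ∀ c B .{{_ : NonZero c}} M h₁ h₂ L →
    #solutions (c ℕ.* B) (shiftedForm (M * + c) (h₁ * + c) (h₂ * + c) (L * + c)) ≡
    c ℕ.* (c ℕ.* #solutions B (shiftedForm M h₁ h₂ L))
  #solutions-scale c B M h₁ h₂ L = begin
    #solutions (c ℕ.* B) (shiftedForm (M * + c) (h₁ * + c) (h₂ * + c) (L * + c))
      ≡⟨ ∑-cong (c ℕ.* B) (λ {x} _ → ∑-cong (c ℕ.* B) λ {y} _ →
           trans (cong (𝟙[_] ∘ (+ (c ℕ.* B) ∣?_)) (factorise M h₁ h₂ L (+ c) (+ x) (+ y)))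
                 (𝟙∣-cancelˡ c (F (+ x) (+ y)))) ⟩
    ∑[ x < c ℕ.* B ] ∑[ y < c ℕ.* B ] 𝟙[ + B ∣? F (+ x) (+ y) ]
      ≡⟨ ∑-cong (c ℕ.* B) (λ {x} _ → ∑-periodic c B _ λ y →
           𝟙∣-cong (shiftedForm-cong M h₁ h₂ L (≡mod-refl {i = + x}) (+-shift-mod y))) ⟩
    ∑[ x < c ℕ.* B ] (c ℕ.* ∑[ y < B ] 𝟙[ + B ∣? F (+ x) (+ y) ])
      ≡⟨ ∑-distribˡ-* (c ℕ.* B) c _ ⟩
    c ℕ.* ∑[ x < c ℕ.* B ] ∑[ y < B ] 𝟙[ + B ∣? F (+ x) (+ y) ]
      ≡⟨ cong (c ℕ.*_) (∑-periodic c B _ λ x → ∑-cong B λ {y} _ →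
           𝟙∣-cong (shiftedForm-cong M h₁ h₂ L (+-shift-mod x) (≡mod-refl {i = + y}))) ⟩
    c ℕ.* (c ℕ.* #solutions B F)
      ∎
    where
    open ≡-Reasoning
    F = shiftedForm M h₁ h₂ L
    factorise : ∀ M h₁ h₂ L C X Y →
      M * C * X * Y - X * (h₂ * C) - Y * (h₁ * C) + L * C ≡ C * (M * X * Y - X * h₂ - Y * h₁ + L)
    factorise = solve-∀

  shiftedForm-complete-product : ∀ {B} .{{_ : NonZero B}} M h₁ h₂ L x y →
    M * shiftedForm M h₁ h₂ L (+ x) (+ y) ≡
    shiftedForm 1ℤ 0ℤ 0ℤ (M * L - h₁ * h₂) (+ ((M * + x - h₁) %ℕ B)) (+ ((M * + y - h₂) %ℕ B)) mod B
  shiftedForm-complete-product {B} M h₁ h₂ L x y = begin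
    M * shiftedForm M h₁ h₂ L (+ x) (+ y)       ≡⟨ factorise M h₁ h₂ L (+ x) (+ y) ⟩
    (M * + x - h₁) * (M * + y - h₂) + t         ≈⟨ +-congʳ-mod t (*-cong-mod (≡mod-sym (%ℕ-≡mod (M * + x - h₁)))
                                                                             (≡mod-sym (%ℕ-≡mod (M * + y - h₂)))) ⟩
    + X * + Y + t                               ≡⟨ normalise (+ X) (+ Y) t ⟨
    shiftedForm 1ℤ 0ℤ 0ℤ t (+ X) (+ Y)          ∎
    where
    open ≡mod-Reasoning B
    t = M * L - h₁ * h₂
    X = (M * + x - h₁) %ℕ B
    Y = (M * + y - h₂) %ℕ B
    factorise : ∀ M h₁ h₂ L X Y →
      M * (M * X * Y - X * h₂ - Y * h₁ + L) ≡ (M * X - h₁) * (M * Y - h₂) + (M * L - h₁ * h₂)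
    factorise = solve-∀
    normalise : ∀ X Y t → 1ℤ * X * Y - X * 0ℤ - Y * 0ℤ + t ≡ X * Y + t
    normalise = solve-∀

  #solutions-unit : ∀ {B} .{{_ : NonZero B}} {M} → Invertible B M → ∀ h₁ h₂ L →
    #solutions B (shiftedForm M h₁ h₂ L) ≡ #solutions B (shiftedForm 1ℤ 0ℤ 0ℤ (M * L - h₁ * h₂))
  #solutions-unit {B} {M} M⁻¹ h₁ h₂ L = begin
    #solutions B F
      ≡⟨ ∑-cong B (λ {x} _ → ∑-cong B λ {y} _ → 𝟙-⇔ (mk⇔ (∣n⇒∣m*n M) (invertible-cancelˡ M⁻¹)) _ _) ⟩
    ∑[ x < B ] ∑[ y < B ] 𝟙[ + B ∣? M * F (+ x) (+ y) ]
      ≡⟨ ∑-cong B (λ {x} _ → ∑-cong B λ {y} _ → 𝟙∣-cong (shiftedForm-complete-product M h₁ h₂ L x y)) ⟩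
    ∑[ x < B ] ∑[ y < B ] 𝟙[ + B ∣? G (+ σ₁ x) (+ σ₂ y) ]
      ≡⟨ ∑-cong B (λ {x} _ →
           ∑-permute (affine-isPermutation M⁻¹ (- h₂)) (λ Y → 𝟙[ + B ∣? G (+ σ₁ x) (+ Y) ])) ⟩
    ∑[ x < B ] ∑[ Y < B ] 𝟙[ + B ∣? G (+ σ₁ x) (+ Y) ]
      ≡⟨ ∑-permute (affine-isPermutation M⁻¹ (- h₁)) (λ X → ∑[ Y < B ] 𝟙[ + B ∣? G (+ X) (+ Y) ]) ⟩
    #solutions B G
      ∎
    where
    open ≡-Reasoning
    F = shiftedForm M h₁ h₂ L
    t = M * L - h₁ * h₂
    G = shiftedForm 1ℤ 0ℤ 0ℤ t
    σ₁ σ₂ : ℕ → ℕ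
    σ₁ x = (M * + x - h₁) %ℕ B
    σ₂ y = (M * + y - h₂) %ℕ B

module IntegerEmbedding where
  open import Defs using (⟦_⟧; _/ℤ_; Q; ZeroMod; zeroMod?; repNum)
  open Counting
  open SolutionCounts
  open import Data.Nat.Base as ℕ using (ℕ; suc)
  import Data.Nat.Properties as ℕP
  open import Data.Integer.Base as ℤ using (ℤ; +_; -[1+_]; 0ℤ; 1ℤ)
  import Data.Integer.Properties as ℤP
  open import Data.Integer.Divisibility.Signed using (_∣_)
  open import Data.Integer.GCD using (gcd-zeroʳ)
  open import Data.Integer.Tactic.RingSolver using (solve-∀)
  open import Data.Rational.Base using (ℚ; 0ℚ; 1ℚ; _+_; _*_; _-_; -_; _/_; toℚᵘ; fromℚᵘ)
  import Data.Rational.Properties as ℚP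
  open import Data.Rational.Unnormalised.Base as ℚᵘ using (mkℚᵘ; *≡*)
  import Data.Rational.Unnormalised.Properties as ℚᵘP
  open import Data.Rational.Solver using (module +-*-Solver)
  open import Data.Fin.Base using (toℕ)
  open import Data.Product.Base using (_,_)
  open import Function.Bundles using (_⇔_; mk⇔)
  open import Relation.Binary.PropositionalEquality

  fromℚᵘ-homo-+ : ∀ p q → fromℚᵘ (p ℚᵘ.+ q) ≡ fromℚᵘ p + fromℚᵘ q
  fromℚᵘ-homo-+ p q = ℚP.toℚᵘ-injective (begin
    toℚᵘ (fromℚᵘ (p ℚᵘ.+ q))              ≈⟨ ℚP.toℚᵘ-fromℚᵘ (p ℚᵘ.+ q) ⟩
    p ℚᵘ.+ q                               ≈⟨ ℚᵘP.+-cong (ℚP.toℚᵘ-fromℚᵘ p) (ℚP.toℚᵘ-fromℚᵘ q) ⟨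
    toℚᵘ (fromℚᵘ p) ℚᵘ.+ toℚᵘ (fromℚᵘ q)  ≈⟨ ℚP.toℚᵘ-homo-+ (fromℚᵘ p) (fromℚᵘ q) ⟨
    toℚᵘ (fromℚᵘ p + fromℚᵘ q)            ∎)
    where open ℚᵘP.≃-Reasoning

  fromℚᵘ-homo-* : ∀ p q → fromℚᵘ (p ℚᵘ.* q) ≡ fromℚᵘ p * fromℚᵘ q
  fromℚᵘ-homo-* p q = ℚP.toℚᵘ-injective (begin
    toℚᵘ (fromℚᵘ (p ℚᵘ.* q))              ≈⟨ ℚP.toℚᵘ-fromℚᵘ (p ℚᵘ.* q) ⟩
    p ℚᵘ.* q                               ≈⟨ ℚᵘP.*-cong (ℚP.toℚᵘ-fromℚᵘ p) (ℚP.toℚᵘ-fromℚᵘ q) ⟨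
    toℚᵘ (fromℚᵘ p) ℚᵘ.* toℚᵘ (fromℚᵘ q)  ≈⟨ ℚP.toℚᵘ-homo-* (fromℚᵘ p) (fromℚᵘ q) ⟨
    toℚᵘ (fromℚᵘ p * fromℚᵘ q)            ∎)
    where open ℚᵘP.≃-Reasoning

  fromℚᵘ-homo‿- : ∀ p → fromℚᵘ (ℚᵘ.- p) ≡ - fromℚᵘ p
  fromℚᵘ-homo‿- p = ℚP.toℚᵘ-injective (begin
    toℚᵘ (fromℚᵘ (ℚᵘ.- p))                ≈⟨ ℚP.toℚᵘ-fromℚᵘ (ℚᵘ.- p) ⟩
    ℚᵘ.- p                                 ≈⟨ ℚᵘP.-‿cong (ℚP.toℚᵘ-fromℚᵘ p) ⟨
    ℚᵘ.- toℚᵘ (fromℚᵘ p)                  ≈⟨ ℚP.toℚᵘ-homo‿- (fromℚᵘ p) ⟨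
    toℚᵘ (- fromℚᵘ p)                     ∎)
    where open ℚᵘP.≃-Reasoning

  ⟦⟧-homo-+ : ∀ a b → ⟦ a ℤ.+ b ⟧ ≡ ⟦ a ⟧ + ⟦ b ⟧
  ⟦⟧-homo-+ a b = trans (ℚP.fromℚᵘ-cong {mkℚᵘ (a ℤ.+ b) 0} {mkℚᵘ a 0 ℚᵘ.+ mkℚᵘ b 0} (*≡* (regroup a b)))
                        (fromℚᵘ-homo-+ (mkℚᵘ a 0) (mkℚᵘ b 0))
    where regroup : ∀ a b → (a ℤ.+ b) ℤ.* 1ℤ ≡ (a ℤ.* 1ℤ ℤ.+ b ℤ.* 1ℤ) ℤ.* 1ℤ
          regroup = solve-∀

  ⟦⟧-homo-* : ∀ a b → ⟦ a ℤ.* b ⟧ ≡ ⟦ a ⟧ * ⟦ b ⟧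
  ⟦⟧-homo-* a b = fromℚᵘ-homo-* (mkℚᵘ a 0) (mkℚᵘ b 0)

  ⟦⟧-homo-- : ∀ a b → ⟦ a ℤ.- b ⟧ ≡ ⟦ a ⟧ - ⟦ b ⟧
  ⟦⟧-homo-- a b = trans (⟦⟧-homo-+ a (ℤ.- b)) (cong (λ q → ⟦ a ⟧ + q) (fromℚᵘ-homo‿- (mkℚᵘ b 0)))

  mkℚᵘ-* : ∀ a b n → mkℚᵘ (a ℤ.* b) n ℚᵘ.≃ mkℚᵘ a 0 ℚᵘ.* mkℚᵘ b n
  mkℚᵘ-* a b n = *≡* (cong (λ m → a ℤ.* b ℤ.* + suc m) (ℕP.+-identityʳ n))

  N/ℤN≡1 : ∀ N .{{_ : ℤ.NonZero N}} → N /ℤ N ≡ 1ℚ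
  N/ℤN≡1 (+ suc n)  = ℚP.fromℚᵘ-cong {mkℚᵘ (+ suc n) n} {mkℚᵘ 1ℤ 0} (*≡* (ℤP.*-comm (+ suc n) 1ℤ))
  N/ℤN≡1 -[1+ n ]   = ℚP.fromℚᵘ-cong {mkℚᵘ (+ suc n) n} {mkℚᵘ 1ℤ 0} (*≡* (ℤP.*-comm (+ suc n) 1ℤ))

  /ℤ-as-* : ∀ a N .{{_ : ℤ.NonZero N}} → a /ℤ N ≡ ⟦ a ⟧ * (1ℤ /ℤ N)
  /ℤ-as-* a (+ suc n) = begin
    fromℚᵘ (mkℚᵘ a n)                        ≡⟨ cong (λ z → fromℚᵘ (mkℚᵘ z n)) (ℤP.*-identityʳ a) ⟨
    fromℚᵘ (mkℚᵘ (a ℤ.* 1ℤ) n)               ≡⟨ ℚP.fromℚᵘ-cong (mkℚᵘ-* a 1ℤ n) ⟩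
    fromℚᵘ (mkℚᵘ a 0 ℚᵘ.* mkℚᵘ 1ℤ n)         ≡⟨ fromℚᵘ-homo-* (mkℚᵘ a 0) (mkℚᵘ 1ℤ n) ⟩
    ⟦ a ⟧ * fromℚᵘ (mkℚᵘ 1ℤ n)               ∎
    where open ≡-Reasoning
  /ℤ-as-* a -[1+ n ] = begin
    fromℚᵘ (mkℚᵘ (ℤ.- a) n)                  ≡⟨ cong (λ z → fromℚᵘ (mkℚᵘ z n)) (negate a) ⟩
    fromℚᵘ (mkℚᵘ (a ℤ.* ℤ.- 1ℤ) n)           ≡⟨ ℚP.fromℚᵘ-cong (mkℚᵘ-* a (ℤ.- 1ℤ) n) ⟩
    fromℚᵘ (mkℚᵘ a 0 ℚᵘ.* mkℚᵘ (ℤ.- 1ℤ) n)   ≡⟨ fromℚᵘ-homo-* (mkℚᵘ a 0) (mkℚᵘ (ℤ.- 1ℤ) n) ⟩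
    ⟦ a ⟧ * fromℚᵘ (mkℚᵘ (ℤ.- 1ℤ) n)         ∎
    where
    open ≡-Reasoning
    negate : ∀ a → ℤ.- a ≡ a ℤ.* ℤ.- 1ℤ
    negate = solve-∀

  ⟦N⟧*1/N≡1 : ∀ N .{{_ : ℤ.NonZero N}} → ⟦ N ⟧ * (1ℤ /ℤ N) ≡ 1ℚ
  ⟦N⟧*1/N≡1 N = begin
    ⟦ N ⟧ * (1ℤ /ℤ N)    ≡⟨ /ℤ-as-* N N ⟨
    N /ℤ N               ≡⟨ N/ℤN≡1 N ⟩
    1ℚ                   ∎
    where open ≡-Reasoning

  clear-denominators : ∀ A I X Y G₁ G₂ L → A * I ≡ 1ℚ →
    A * (X - G₁ * I) * (Y - G₂ * I) + (L - G₁ * G₂ * I) ≡ A * X * Y - X * G₂ - Y * G₁ + L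
  clear-denominators A I X Y G₁ G₂ L AI≡1 = begin
    A * (X - G₁ * I) * (Y - G₂ * I) + (L - G₁ * G₂ * I)  ≡⟨ expand A I X Y G₁ G₂ L ⟩
    R + (1ℚ - A * I) * W                                 ≡⟨ cong (λ e → R + (1ℚ - e) * W) AI≡1 ⟩
    R + (1ℚ - 1ℚ) * W                                    ≡⟨ vanish R W ⟩
    R                                                    ∎
    where
    open ≡-Reasoning
    open +-*-Solver using (solve; _:=_; _:+_; _:-_; _:*_; con)
    R = A * X * Y - X * G₂ - Y * G₁ + L
    W = X * G₂ + Y * G₁ - G₁ * G₂ * I
    expand : ∀ A I X Y G₁ G₂ L → A * (X - G₁ * I) * (Y - G₂ * I) + (L - G₁ * G₂ * I)
      ≡ (A * X * Y - X * G₂ - Y * G₁ + L) + (1ℚ - A * I) * (X * G₂ + Y * G₁ - G₁ * G₂ * I)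
    expand = solve 7 (λ A I X Y G₁ G₂ L → A :* (X :- G₁ :* I) :* (Y :- G₂ :* I) :+ (L :- G₁ :* G₂ :* I)
      := (A :* X :* Y :- X :* G₂ :- Y :* G₁ :+ L) :+ (con 1ℚ :- A :* I) :* (X :* G₂ :+ Y :* G₁ :- G₁ :* G₂ :* I)) refl
    vanish : ∀ R W → R + (1ℚ - 1ℚ) * W ≡ R
    vanish = solve 2 (λ R W → R :+ (con 1ℚ :- con 1ℚ) :* W := R) refl

  ⟦⟧-shiftedForm : ∀ N g₁ g₂ ℓ X Y →
    ⟦ shiftedForm N g₁ g₂ ℓ X Y ⟧ ≡ ⟦ N ⟧ * ⟦ X ⟧ * ⟦ Y ⟧ - ⟦ X ⟧ * ⟦ g₂ ⟧ - ⟦ Y ⟧ * ⟦ g₁ ⟧ + ⟦ ℓ ⟧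
  ⟦⟧-shiftedForm N g₁ g₂ ℓ X Y = begin
    ⟦ N ℤ.* X ℤ.* Y ℤ.- X ℤ.* g₂ ℤ.- Y ℤ.* g₁ ℤ.+ ℓ ⟧
      ≡⟨ ⟦⟧-homo-+ (N ℤ.* X ℤ.* Y ℤ.- X ℤ.* g₂ ℤ.- Y ℤ.* g₁) ℓ ⟩
    ⟦ N ℤ.* X ℤ.* Y ℤ.- X ℤ.* g₂ ℤ.- Y ℤ.* g₁ ⟧ + ⟦ ℓ ⟧
      ≡⟨ cong (_+ ⟦ ℓ ⟧) (⟦⟧-homo-- (N ℤ.* X ℤ.* Y ℤ.- X ℤ.* g₂) (Y ℤ.* g₁)) ⟩
    ⟦ N ℤ.* X ℤ.* Y ℤ.- X ℤ.* g₂ ⟧ - ⟦ Y ℤ.* g₁ ⟧ + ⟦ ℓ ⟧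
      ≡⟨ cong₂ (λ u v → u - v + ⟦ ℓ ⟧) (⟦⟧-homo-- (N ℤ.* X ℤ.* Y) (X ℤ.* g₂)) (⟦⟧-homo-* Y g₁) ⟩
    ⟦ N ℤ.* X ℤ.* Y ⟧ - ⟦ X ℤ.* g₂ ⟧ - ⟦ Y ⟧ * ⟦ g₁ ⟧ + ⟦ ℓ ⟧
      ≡⟨ cong₂ (λ u v → u - v - ⟦ Y ⟧ * ⟦ g₁ ⟧ + ⟦ ℓ ⟧)
               (trans (⟦⟧-homo-* (N ℤ.* X) Y) (cong (_* ⟦ Y ⟧) (⟦⟧-homo-* N X))) (⟦⟧-homo-* X g₂) ⟩
    ⟦ N ⟧ * ⟦ X ⟧ * ⟦ Y ⟧ - ⟦ X ⟧ * ⟦ g₂ ⟧ - ⟦ Y ⟧ * ⟦ g₁ ⟧ + ⟦ ℓ ⟧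
      ∎
    where open ≡-Reasoning

  Q[r-γ]+n≡⟦shiftedForm⟧ : ∀ N .{{_ : ℤ.NonZero N}} g₁ g₂ ℓ X Y →
    Q N (⟦ X ⟧ - g₁ /ℤ N , ⟦ Y ⟧ - g₂ /ℤ N) + (⟦ ℓ ⟧ - (g₁ ℤ.* g₂) /ℤ N) ≡ ⟦ shiftedForm N g₁ g₂ ℓ X Y ⟧
  Q[r-γ]+n≡⟦shiftedForm⟧ N g₁ g₂ ℓ X Y = begin
    ⟦ N ⟧ * (⟦ X ⟧ - g₁ /ℤ N) * (⟦ Y ⟧ - g₂ /ℤ N) + (⟦ ℓ ⟧ - (g₁ ℤ.* g₂) /ℤ N)
      ≡⟨ cong₂ (λ u v → ⟦ N ⟧ * (⟦ X ⟧ - u) * (⟦ Y ⟧ - v) + (⟦ ℓ ⟧ - (g₁ ℤ.* g₂) /ℤ N))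
               (/ℤ-as-* g₁ N) (/ℤ-as-* g₂ N) ⟩
    ⟦ N ⟧ * (⟦ X ⟧ - ⟦ g₁ ⟧ * I) * (⟦ Y ⟧ - ⟦ g₂ ⟧ * I) + (⟦ ℓ ⟧ - (g₁ ℤ.* g₂) /ℤ N)
      ≡⟨ cong (λ u → ⟦ N ⟧ * (⟦ X ⟧ - ⟦ g₁ ⟧ * I) * (⟦ Y ⟧ - ⟦ g₂ ⟧ * I) + (⟦ ℓ ⟧ - u))
              (trans (/ℤ-as-* (g₁ ℤ.* g₂) N) (cong (_* I) (⟦⟧-homo-* g₁ g₂))) ⟩
    ⟦ N ⟧ * (⟦ X ⟧ - ⟦ g₁ ⟧ * I) * (⟦ Y ⟧ - ⟦ g₂ ⟧ * I) + (⟦ ℓ ⟧ - ⟦ g₁ ⟧ * ⟦ g₂ ⟧ * I)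
      ≡⟨ clear-denominators ⟦ N ⟧ I ⟦ X ⟧ ⟦ Y ⟧ ⟦ g₁ ⟧ ⟦ g₂ ⟧ ⟦ ℓ ⟧ (⟦N⟧*1/N≡1 N) ⟩
    ⟦ N ⟧ * ⟦ X ⟧ * ⟦ Y ⟧ - ⟦ X ⟧ * ⟦ g₂ ⟧ - ⟦ Y ⟧ * ⟦ g₁ ⟧ + ⟦ ℓ ⟧
      ≡⟨ ⟦⟧-shiftedForm N g₁ g₂ ℓ X Y ⟨
    ⟦ shiftedForm N g₁ g₂ ℓ X Y ⟧
      ∎
    where
    open ≡-Reasoning
    I = 1ℤ /ℤ N

  ↥⟦⟧ : ∀ z → ℚ.numerator ⟦ z ⟧ ≡ z
  ↥⟦⟧ z = trans (sym (ℤP.*-identityʳ _))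
                (trans (cong (ℚ.numerator ⟦ z ⟧ ℤ.*_) (sym (gcd-zeroʳ z))) (ℚP.↥-/ z 1))

  ↧⟦⟧ : ∀ z → ℚ.denominatorℕ ⟦ z ⟧ ≡ 1
  ↧⟦⟧ z = ℤP.+-injective (trans (sym (ℤP.*-identityʳ _))
                                (trans (cong (ℚ.denominator ⟦ z ⟧ ℤ.*_) (sym (gcd-zeroʳ z))) (ℚP.↧-/ z 1)))

  ZeroMod-⟦⟧ : ∀ a z → ZeroMod a ⟦ z ⟧ ⇔ + a ∣ z
  ZeroMod-⟦⟧ a z = mk⇔ (λ (_ , a∣↥) → subst (+ a ∣_) (↥⟦⟧ z) a∣↥)
                       (λ a∣z → ↧⟦⟧ z , subst (+ a ∣_) (sym (↥⟦⟧ z)) a∣z)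

  repNum≡#solutions : ∀ N .{{_ : ℤ.NonZero N}} g₁ g₂ ℓ a →
    repNum N (g₁ /ℤ N , g₂ /ℤ N) (⟦ ℓ ⟧ - (g₁ ℤ.* g₂) /ℤ N) a ≡ #solutions a (shiftedForm N g₁ g₂ ℓ)
  repNum≡#solutions N g₁ g₂ ℓ a = count-allFin² a _ _ λ x y →
    trans (cong (λ q → 𝟙[ zeroMod? a q ]) (Q[r-γ]+n≡⟦shiftedForm⟧ N g₁ g₂ ℓ (+ toℕ x) (+ toℕ y)))
          (𝟙-⇔ (ZeroMod-⟦⟧ a _) _ _)

  -- (0ℤ /ℤ + 1 , 0ℤ /ℤ + 1) computes to (0ℚ , 0ℚ); only n = ⟦ t ⟧ - 0ℚ needs rewriting.
  repNum-U1≡#solutions : ∀ t b → repNum (+ 1) (0ℚ , 0ℚ) ⟦ t ⟧ b ≡ #solutions b (shiftedForm 1ℤ 0ℤ 0ℤ t)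
  repNum-U1≡#solutions t b =
    trans (cong (λ n → repNum (+ 1) (0ℚ , 0ℚ) n b) (sym (ℚP.+-identityʳ ⟦ t ⟧))) (repNum≡#solutions (+ 1) 0ℤ 0ℤ t b)

  rescaled-n≡⟦t⟧ : ∀ N .{{_ : ℤ.NonZero N}} g₁ g₂ ℓ m .{{_ : ℕ.NonZero m}} t →
    N ℤ.* ℓ ℤ.- g₁ ℤ.* g₂ ≡ t ℤ.* + m →
    (⟦ N ⟧ * (⟦ ℓ ⟧ - (g₁ ℤ.* g₂) /ℤ N)) * (1ℤ / m) ≡ ⟦ t ⟧
  rescaled-n≡⟦t⟧ N g₁ g₂ ℓ m t eq = begin
    (⟦ N ⟧ * (⟦ ℓ ⟧ - (g₁ ℤ.* g₂) /ℤ N)) * (1ℤ / m)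
      ≡⟨ cong (λ u → (⟦ N ⟧ * (⟦ ℓ ⟧ - u)) * (1ℤ / m)) (/ℤ-as-* (g₁ ℤ.* g₂) N) ⟩
    (⟦ N ⟧ * (⟦ ℓ ⟧ - ⟦ g₁ ℤ.* g₂ ⟧ * I)) * (1ℤ / m)
      ≡⟨ cong (_* (1ℤ / m)) (distribute ⟦ N ⟧ ⟦ ℓ ⟧ ⟦ g₁ ℤ.* g₂ ⟧ I) ⟩
    (⟦ N ⟧ * ⟦ ℓ ⟧ - ⟦ g₁ ℤ.* g₂ ⟧ * (⟦ N ⟧ * I)) * (1ℤ / m)
      ≡⟨ cong (λ u → (⟦ N ⟧ * ⟦ ℓ ⟧ - ⟦ g₁ ℤ.* g₂ ⟧ * u) * (1ℤ / m)) (⟦N⟧*1/N≡1 N) ⟩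
    (⟦ N ⟧ * ⟦ ℓ ⟧ - ⟦ g₁ ℤ.* g₂ ⟧ * 1ℚ) * (1ℤ / m)
      ≡⟨ cong (λ u → (⟦ N ⟧ * ⟦ ℓ ⟧ - u) * (1ℤ / m)) (ℚP.*-identityʳ _) ⟩
    (⟦ N ⟧ * ⟦ ℓ ⟧ - ⟦ g₁ ℤ.* g₂ ⟧) * (1ℤ / m)
      ≡⟨ cong (_* (1ℤ / m))
              (trans (⟦⟧-homo-- (N ℤ.* ℓ) (g₁ ℤ.* g₂)) (cong (_- ⟦ g₁ ℤ.* g₂ ⟧) (⟦⟧-homo-* N ℓ))) ⟨
    ⟦ N ℤ.* ℓ ℤ.- g₁ ℤ.* g₂ ⟧ * (1ℤ / m)
      ≡⟨ cong (λ u → ⟦ u ⟧ * (1ℤ / m)) eq ⟩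
    ⟦ t ℤ.* + m ⟧ * (1ℤ / m)
      ≡⟨ trans (cong (_* (1ℤ / m)) (⟦⟧-homo-* t (+ m))) (ℚP.*-assoc ⟦ t ⟧ ⟦ + m ⟧ (1ℤ / m)) ⟩
    ⟦ t ⟧ * (⟦ + m ⟧ * (1ℤ / m))
      ≡⟨ cong (⟦ t ⟧ *_) (m*1/m m) ⟩
    ⟦ t ⟧ * 1ℚ
      ≡⟨ ℚP.*-identityʳ ⟦ t ⟧ ⟩
    ⟦ t ⟧
      ∎
    where
    open ≡-Reasoning
    open +-*-Solver using (solve; _:=_; _:-_; _:*_)
    I = 1ℤ /ℤ N
    distribute : ∀ A L G I → A * (L - G * I) ≡ A * L - G * (A * I)
    distribute = solve 4 (λ A L G I → A :* (L :- G :* I) := A :* L :- G :* (A :* I)) refl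
    m*1/m : ∀ m .{{_ : ℕ.NonZero m}} → ⟦ + m ⟧ * (1ℤ / m) ≡ 1ℚ
    m*1/m (suc m) = ⟦N⟧*1/N≡1 (+ suc m)

module PrimePowerCases where
  open import Defs
  open ModularArithmetic using (prime∤⇒invertible)
  open SolutionCounts
  open IntegerEmbedding using (repNum≡#solutions; repNum-U1≡#solutions; rescaled-n≡⟦t⟧)
  open import Data.Nat.Base as ℕ using (ℕ; suc; _^_; _≤_; _<_; _∸_)
  import Data.Nat.Properties as ℕP
  open import Data.Nat.Divisibility using (m∣m*n) renaming (_∣_ to _∣ℕ_)
  open import Data.Nat.Primality using (Prime)
  open import Data.Integer.Base as ℤ using (ℤ; +_; 0ℤ; 1ℤ)
  import Data.Integer.Properties as ℤP
  open import Data.Integer.Divisibility.Signed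
  import Data.Integer.GCD as ℤ
  open import Data.Integer.Tactic.RingSolver using (solve-∀)
  open import Data.Rational.Base as ℚ using (0ℚ)
  open import Data.Maybe.Base using (just; nothing)
  open import Data.Product.Base using (_×_; _,_; proj₁; proj₂)
  open import Relation.Nullary using (¬_; yes; no)
  open import Relation.Binary.PropositionalEquality

  ^-split : ∀ p {s ν} → s ≤ ν → p ^ ν ≡ p ^ s ℕ.* p ^ (ν ∸ s)
  ^-split p {s} {ν} s≤ν = trans (cong (p ^_) (sym (ℕP.m+[n∸m]≡n s≤ν))) (ℕP.^-distribˡ-+-* p s (ν ∸ s))

  ^-monoʳ-∣ : ∀ p {m n} → m ≤ n → + (p ^ m) ∣ + (p ^ n)
  ^-monoʳ-∣ p {m} {n} m≤n = ∣ᵤ⇒∣ (subst (p ^ m ∣ℕ_) (sym (^-split p m≤n)) (m∣m*n (p ^ (n ∸ m))))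

  ^-double : ∀ p e → p ^ (2 ℕ.* e) ≡ p ^ e ℕ.* p ^ e
  ^-double p e = trans (cong (λ k → p ^ (e ℕ.+ k)) (ℕP.+-identityʳ e)) (ℕP.^-distribˡ-+-* p e e)

  minM≤ν : ∀ ν νγ → minM ν νγ ≤ ν
  minM≤ν ν nothing  = ℕP.≤-refl
  minM≤ν ν (just s) = ℕP.m⊓n≤m ν s

  IsNuGamma⇒∣ : ∀ {p g₁ g₂} ν νγ → IsNuGamma p g₁ g₂ νγ → ∀ {k} → k ≤ minM ν νγ →
                + (p ^ k) ∣ g₁ × + (p ^ k) ∣ g₂
  IsNuGamma⇒∣ ν nothing (refl , refl) _ = divides 0ℤ refl , divides 0ℤ refl
  IsNuGamma⇒∣ {p} {g₁} {g₂} ν (just s) (p^s∣gcd , _) k≤ν⊓s =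
    ∣-trans p^k∣gcd (∣ᵤ⇒∣ (ℤ.gcd[i,j]∣i g₁ g₂)) , ∣-trans p^k∣gcd (∣ᵤ⇒∣ (ℤ.gcd[i,j]∣j g₁ g₂))
    where p^k∣gcd = ∣-trans (^-monoʳ-∣ p (ℕP.≤-trans k≤ν⊓s (ℕP.m⊓n≤n ν s))) p^s∣gcd

  IsNuGamma-exact : ∀ {p g₁ g₂ s} → IsNuGamma p g₁ g₂ (just s) → ¬ (+ (p ^ suc s) ∣ g₁ × + (p ^ suc s) ∣ g₂)
  IsNuGamma-exact {p} {g₁} {g₂} {s} (_ , p^[1+s]∤gcd) (d₁ , d₂) =
    p^[1+s]∤gcd (∣ᵤ⇒∣ (ℤ.gcd-greatest {g₁} {g₂} {+ (p ^ suc s)} (∣⇒∣ᵤ d₁) (∣⇒∣ᵤ d₂)))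

  repNum-νN≤minM : ∀ {p} (pr : Prime p) ν N .{{_ : ℤ.NonZero N}} g₁ g₂ ℓ e → (p ∥ N) e →
    + (p ^ e) ∣ g₁ → + (p ^ e) ∣ g₂ → + (p ^ e) ∣ ℓ → e ≤ ν →
    repNum N (g₁ /ℤ N , g₂ /ℤ N) (⟦ ℓ ⟧ ℚ.- (g₁ ℤ.* g₂) /ℤ N) (p ^ ν) ≡
    p ^ (2 ℕ.* e) ℕ.* repNum (+ 1) (0ℚ , 0ℚ)
      ((⟦ N ⟧ ℚ.* (⟦ ℓ ⟧ ℚ.- (g₁ ℤ.* g₂) /ℤ N)) ℚ.* ℚ._/_ 1ℤ (p ^ (2 ℕ.* e)) {{prime^≢0 pr (2 ℕ.* e)}})
      (p ^ (ν ∸ e))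
  repNum-νN≤minM {p} pr ν _ _ _ _ e (divides M refl , p^[1+e]∤N) (divides h₁ refl) (divides h₂ refl) (divides L refl) e≤ν =
    begin
    repNum N (g₁ /ℤ N , g₂ /ℤ N) n (p ^ ν)
      ≡⟨ repNum≡#solutions N g₁ g₂ ℓ (p ^ ν) ⟩
    #solutions (p ^ ν) (shiftedForm N g₁ g₂ ℓ)
      ≡⟨ cong (λ a → #solutions a (shiftedForm N g₁ g₂ ℓ)) (^-split p e≤ν) ⟩
    #solutions (p ^ e ℕ.* B) (shiftedForm N g₁ g₂ ℓ)
      ≡⟨ #solutions-scale (p ^ e) B {{prime^≢0 pr e}} M h₁ h₂ L ⟩
    p ^ e ℕ.* (p ^ e ℕ.* #solutions B (shiftedForm M h₁ h₂ L))
      ≡⟨ cong (λ c → p ^ e ℕ.* (p ^ e ℕ.* c)) (#solutions-unit {{prime^≢0 pr (ν ∸ e)}} M⁻¹ h₁ h₂ L) ⟩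
    p ^ e ℕ.* (p ^ e ℕ.* #solutions B (shiftedForm 1ℤ 0ℤ 0ℤ t))
      ≡⟨ trans (cong (ℕ._* #solutions B G) (^-double p e)) (ℕP.*-assoc (p ^ e) (p ^ e) (#solutions B G)) ⟨
    p ^ (2 ℕ.* e) ℕ.* #solutions B (shiftedForm 1ℤ 0ℤ 0ℤ t)
      ≡⟨ cong (p ^ (2 ℕ.* e) ℕ.*_) (repNum-U1≡#solutions t B) ⟨
    p ^ (2 ℕ.* e) ℕ.* repNum (+ 1) (0ℚ , 0ℚ) ⟦ t ⟧ B
      ≡⟨ cong (λ ñ → p ^ (2 ℕ.* e) ℕ.* repNum (+ 1) (0ℚ , 0ℚ) ñ B)
              (rescaled-n≡⟦t⟧ N g₁ g₂ ℓ (p ^ (2 ℕ.* e)) {{prime^≢0 pr (2 ℕ.* e)}} t N*ℓ-g₁*g₂≡t*p^2e) ⟨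
    p ^ (2 ℕ.* e) ℕ.* repNum (+ 1) (0ℚ , 0ℚ)
      ((⟦ N ⟧ ℚ.* n) ℚ.* ℚ._/_ 1ℤ (p ^ (2 ℕ.* e)) {{prime^≢0 pr (2 ℕ.* e)}}) B
      ∎
    where
    open ≡-Reasoning
    P = + (p ^ e)
    N = M ℤ.* P
    g₁ = h₁ ℤ.* P
    g₂ = h₂ ℤ.* P
    ℓ = L ℤ.* P
    n = ⟦ ℓ ⟧ ℚ.- (g₁ ℤ.* g₂) /ℤ N
    B = p ^ (ν ∸ e)
    t = M ℤ.* L ℤ.- h₁ ℤ.* h₂
    G = shiftedForm 1ℤ 0ℤ 0ℤ t
    p∤M : ¬ + p ∣ M
    p∤M (divides q refl) = p^[1+e]∤N (divides q (trans (ℤP.*-assoc q (+ p) P) (cong (q ℤ.*_) (sym (ℤP.pos-* p (p ^ e))))))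
    M⁻¹ = prime∤⇒invertible pr p∤M (ν ∸ e)
    N*ℓ-g₁*g₂≡t*p^2e : N ℤ.* ℓ ℤ.- g₁ ℤ.* g₂ ≡ t ℤ.* + (p ^ (2 ℕ.* e))
    N*ℓ-g₁*g₂≡t*p^2e = trans (factorise M L h₁ h₂ P)
      (cong (t ℤ.*_) (trans (sym (ℤP.pos-* (p ^ e) (p ^ e))) (cong +_ (sym (^-double p e)))))
      where
      factorise : ∀ M L h₁ h₂ P →
        M ℤ.* P ℤ.* (L ℤ.* P) ℤ.- h₁ ℤ.* P ℤ.* (h₂ ℤ.* P) ≡ (M ℤ.* L ℤ.- h₁ ℤ.* h₂) ℤ.* (P ℤ.* P)
      factorise = solve-∀

  #solutions-p^ν∣coefficients : ∀ p ν {N g₁ g₂ ℓ} → + (p ^ ν) ∣ N → + (p ^ ν) ∣ g₁ → + (p ^ ν) ∣ g₂ → + (p ^ ν) ∣ ℓ →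
                       #solutions (p ^ ν) (shiftedForm N g₁ g₂ ℓ) ≡ p ^ (ν ℕ.+ ν)
  #solutions-p^ν∣coefficients p ν p^ν∣N p^ν∣g₁ p^ν∣g₂ p^ν∣ℓ =
    trans (#solutions-all p^ν∣N p^ν∣g₁ p^ν∣g₂ p^ν∣ℓ) (sym (ℕP.^-distribˡ-+-* p ν ν))

  #solutions-minM<νN : ∀ {p} → Prime p → ∀ ν {N g₁ g₂ ℓ} e → + (p ^ e) ∣ N → ∀ νγ → IsNuGamma p g₁ g₂ νγ →
    minM ν νγ < e → + (p ^ minM ν νγ) ∣ ℓ → #solutions (p ^ ν) (shiftedForm N g₁ g₂ ℓ) ≡ p ^ (ν ℕ.+ minM ν νγ)
  #solutions-minM<νN {p} pr ν e p^e∣N nothing (refl , refl) ν<e p^ν∣ℓ =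
    #solutions-p^ν∣coefficients p ν (∣-trans (^-monoʳ-∣ p (ℕP.<⇒≤ ν<e)) p^e∣N)
                                     (divides 0ℤ refl) (divides 0ℤ refl) p^ν∣ℓ
  #solutions-minM<νN {p} pr ν {N} {g₁} {g₂} {ℓ} e p^e∣N (just s) hγ m<e p^m∣ℓ with ν ℕP.≤? s
  ... | yes ν≤s rewrite ℕP.m≤n⇒m⊓n≡m ν≤s =
    #solutions-p^ν∣coefficients p ν (∣-trans (^-monoʳ-∣ p (ℕP.<⇒≤ m<e)) p^e∣N)
                                     (proj₁ p^ν∣γ) (proj₂ p^ν∣γ) p^m∣ℓ
    where p^ν∣γ = IsNuGamma⇒∣ ν (just s) hγ (ℕP.⊓-glb ℕP.≤-refl ν≤s)
  ... | no ν≰s rewrite ℕP.m≥n⇒m⊓n≡n (ℕP.<⇒≤ (ℕP.≰⇒> ν≰s)) = begin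
    #solutions (p ^ ν) (shiftedForm N g₁ g₂ ℓ)
      ≡⟨ cong (λ a → #solutions a (shiftedForm N g₁ g₂ ℓ)) (^-split p (ℕP.<⇒≤ s<ν)) ⟩
    #solutions (p ^ s ℕ.* p ^ (ν ∸ s)) (shiftedForm N g₁ g₂ ℓ)
      ≡⟨ #solutions-exact pr s (ν ∸ s) (∣-trans (^-monoʳ-∣ p m<e) p^e∣N) (proj₁ p^s∣γ) (proj₂ p^s∣γ)
                          (IsNuGamma-exact {p} {g₁} {g₂} {s} hγ) p^m∣ℓ ⟩
    p ^ s ℕ.* p ^ (ν ∸ s) ℕ.* p ^ s
      ≡⟨ cong (ℕ._* p ^ s) (^-split p (ℕP.<⇒≤ s<ν)) ⟨
    p ^ ν ℕ.* p ^ s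
      ≡⟨ ℕP.^-distribˡ-+-* p ν s ⟨
    p ^ (ν ℕ.+ s)
      ∎
    where
    open ≡-Reasoning
    s<ν = ℕP.≰⇒> ν≰s
    p^s∣γ = IsNuGamma⇒∣ ν (just s) hγ (ℕP.⊓-glb (ℕP.<⇒≤ s<ν) ℕP.≤-refl)

open import Defs
open import Data.Nat as ℕ using (ℕ; _^_; _⊓_; _≤_; _<_; _∸_; _+_; _*_)
import Data.Nat.Properties as ℕP
open import Data.Nat.Primality using (Prime)
open import Data.Integer as ℤ using (ℤ; +_; 1ℤ)
open import Data.Integer.Divisibility.Signed using (_∣_; ∣-trans)
open import Data.Rational as ℚ using (ℚ; 0ℚ)
open import Data.Maybe using (Maybe)
open import Data.Product using (_×_; _,_; proj₁; proj₂)
open import Relation.Nullary using (¬_)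
open import Relation.Binary.PropositionalEquality using (_≡_; trans; subst)
open SolutionCounts using (#solutions-≡0)
open IntegerEmbedding using (repNum≡#solutions)
open PrimePowerCases

lemma3p5 : (p : ℕ) → (pr : Prime p) → (ν : ℕ) → (N : ℤ) → .{{_ : ℤ.NonZero N}} →
    (γ₁ γ₂ : ℤ) → (νN : ℕ) → (p ∥ N) νN → (νγ : Maybe ℕ) → IsNuGamma p γ₁ γ₂ νγ →
    (ℓ : ℤ) →
    let γ = (γ₁ /ℤ N , γ₂ /ℤ N)
        n = ⟦ ℓ ⟧ ℚ.- (γ₁ ℤ.* γ₂) /ℤ N
        νmin = minM ν νγ ⊓ νN
        ñ = (⟦ N ⟧ ℚ.* n) ℚ.* ℚ._/_ 1ℤ (p ^ (2 * νN)) {{prime^≢0 pr (2 * νN)}}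
    in (¬ (+ (p ^ νmin) ∣ ℓ) → repNum N γ n (p ^ ν) ≡ 0)
     × (νN ≤ minM ν νγ → + (p ^ νmin) ∣ ℓ →
          repNum N γ n (p ^ ν) ≡ p ^ (2 * νN) * repNum (+ 1) (0ℚ , 0ℚ) ñ (p ^ (ν ∸ νN)))
     × (minM ν νγ < νN → + (p ^ νmin) ∣ ℓ →
          repNum N γ n (p ^ ν) ≡ p ^ (ν + minM ν νγ))
lemma3p5 p pr ν N γ₁ γ₂ νN p^νN∥N@(p^νN∣N , _) νγ hγ ℓ =
    (λ p^νmin∤ℓ → trans (repNum≡#solutions N γ₁ γ₂ ℓ (p ^ ν))
      (#solutions-≡0 (^-monoʳ-∣ p (ℕP.≤-trans (ℕP.m⊓n≤m m νN) (minM≤ν ν νγ)))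
                     (∣-trans (^-monoʳ-∣ p (ℕP.m⊓n≤n m νN)) p^νN∣N) (proj₁ p^νmin∣γ) (proj₂ p^νmin∣γ) p^νmin∤ℓ))
  , (λ νN≤m p^νmin∣ℓ → let p^νN∣γ = IsNuGamma⇒∣ ν νγ hγ νN≤m in
      repNum-νN≤minM pr ν N γ₁ γ₂ ℓ νN p^νN∥N (proj₁ p^νN∣γ) (proj₂ p^νN∣γ)
        (subst (λ k → + (p ^ k) ∣ ℓ) (ℕP.m≥n⇒m⊓n≡n νN≤m) p^νmin∣ℓ) (ℕP.≤-trans νN≤m (minM≤ν ν νγ)))
  , (λ m<νN p^νmin∣ℓ → trans (repNum≡#solutions N γ₁ γ₂ ℓ (p ^ ν))
      (#solutions-minM<νN pr ν νN p^νN∣N νγ hγ m<νN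
        (subst (λ k → + (p ^ k) ∣ ℓ) (ℕP.m≤n⇒m⊓n≡m (ℕP.<⇒≤ m<νN)) p^νmin∣ℓ)))
  where
  m = minM ν νγ
  p^νmin∣γ = IsNuGamma⇒∣ ν νγ hγ (ℕP.m⊓n≤m m νN)
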